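{- Let $G$ be a graph and let $\ell=\mathrm{OPT}(G)-\mathrm{LP}(G)$. There exists a vertex set $X\subseteq V(G)$ of size at most $2\ell$ such that $\mathrm{OPT}(G-X)=\mathrm{LP}(G-X)$.
   Context: All graphs are finite, simple and undirected. $\mathrm{OPT}(G)$ is the minimum size of a vertex cover of $G$; $\mathrm{LP}(G)=\min\{\sum_{v\in V(G)} x_v: x_u+x_v\ge1\ \forall\{u,v\}\in E(G),\ 0\le x_v\le1\ \forall v\}$.
   Formalization: The variables $x_v$ of the linear programs defining $\mathrm{LP}(G)$ and $\mathrm{LP}(G-X)$ take rational values. -}

module Defs where

open import Data.Nat using (ℕ; zero; suc)
open import Data.Bool using (Bool; true; false)
open import Data.Fin using (Fin)
import Data.Fin as F
open import Data.Fin.Subset using (Subset; _∈_; _⊆_; ∣_∣; ⊤; ∁)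
open import Data.Fin.Subset.Properties using (_∈?_)
open import Data.Integer using (+_)
open import Data.Rational using (ℚ; _/_; _+_; _-_; _*_; _≤_; 0ℚ; 1ℚ)
open import Data.Product using (Σ; _×_; ∃)
open import Relation.Nullary using (¬_; yes; no)
open import Relation.Binary.PropositionalEquality using (_≡_)

record Graph (n : ℕ) : Set where
  field
    adj     : Fin n → Fin n → Bool
    adj-sym : ∀ u v → adj u v ≡ adj v u
    adj-irr : ∀ v → adj v v ≡ false
open Graph public

ℕ→ℚ : ℕ → ℚ
ℕ→ℚ k = + k / 1

Σℚ : ∀ {n} → (Fin n → ℚ) → ℚ
Σℚ {zero}  f = 0ℚ
Σℚ {suc n} f = f F.zero + Σℚ (λ i → f (F.suc i))

-- Throughout, the induced subgraph G[S] for S ⊆ V(G) is represented by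
-- the pair (G , S).  In particular G = G[⊤] and G - X = G[∁ X].

IsVertexCover : ∀ {n} → Graph n → Subset n → Subset n → Set
IsVertexCover G S C =
  C ⊆ S × (∀ u v → u ∈ S → v ∈ S → adj G u v ≡ true → u ∈ C Data.Sum.⊎ v ∈ C)
  where import Data.Sum

IsOPT : ∀ {n} → Graph n → Subset n → ℕ → Set
IsOPT G S k =
  (Σ _ λ C → IsVertexCover G S C × ∣ C ∣ ≡ k)
  × (∀ C → IsVertexCover G S C → k Data.Nat.≤ ∣ C ∣)
  where import Data.Nat

IsFractionalVC : ∀ {n} → Graph n → Subset n → (Fin n → ℚ) → Set
IsFractionalVC G S x =
  (∀ v → v ∈ S → (0ℚ ≤ x v × x v ≤ 1ℚ))
  × (∀ u v → u ∈ S → v ∈ S → adj G u v ≡ true → 1ℚ ≤ x u + x v)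

lpValue : ∀ {n} → Subset n → (Fin n → ℚ) → ℚ
lpValue S x = Σℚ (λ v → val v)
  where
    val : _ → ℚ
    val v with v ∈? S
    ... | yes _ = x v
    ... | no  _ = 0ℚ

IsLP : ∀ {n} → Graph n → Subset n → ℚ → Set
IsLP G S q =
  (Σ _ λ x → IsFractionalVC G S x × lpValue S x ≡ q)
  × (∀ x → IsFractionalVC G S x → q ≤ lpValue S x)

-- Let C be a minimum vertex cover of G (∣ C ∣ = k) and I = ∁ C, which is
-- independent.  Choose T ⊆ C maximising the surplus ∣ T ∣ − ∣ N(T) ∩ I ∣.
-- By maximality, Hall's condition holds for matching C ─ T into I ─ N(T) and
-- for matching N(T) ∩ I into T.  Let X be the part of T left unmatched by the
-- second matching, so ∣ X ∣ = ∣ T ∣ − ∣ N(T) ∩ I ∣ and ∣ C ─ X ∣ is the size of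
-- the two matchings together.  In G − X the matchings are disjoint and inside
-- V ─ X, so every fractional vertex cover of G − X has value ≥ ∣ C ─ X ∣, the
-- size of the vertex cover C ─ X: hence OPT(G − X) = LP(G − X).  On the other
-- hand the half-integral cover (1 on C ─ T, ½ on T and on N(T) ∩ I) of G has
-- value (∣ C ∣ + ∣ C ─ X ∣) / 2 = k − ∣ X ∣ / 2 ≥ LP(G), so ∣ X ∣ ≤ 2 (k − LP(G)).
module Submission where

open import Defs
open import Data.Nat as ℕ using (ℕ; zero; suc; z≤n; s≤s)
import Data.Nat.Properties as ℕP
import Data.Nat.Coprimality as Coprimality
import Data.Integer as ℤ
import Data.Integer.Properties as ℤP
open import Data.Bool using (true; false; if_then_else_)
import Data.Bool as Bool
open import Data.Fin using (Fin)
import Data.Fin as F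
import Data.Fin.Properties as FinP
open import Data.Vec using ([]; _∷_; here; there; tabulate)
import Data.Vec.Properties as VecP
open import Data.Fin.Subset
  using (Subset; inside; outside; _∈_; _∉_; _⊆_; ∣_∣; _∪_; _─_; ⊥; ⊤; ⁅_⁆; ∁; Nonempty)
open import Data.Fin.Subset.Properties
  using ( _∈?_; _⊆?_; anySubset?; nonempty?; drop-there; drop-∷-⊆; out⊆; s⊆s; ⊆-refl; ⊆⊤
        ; Empty-unique; ∣⊥∣≡0; ∉⊥; x∈⁅x⁆; x∈⁅y⁆⇒x≡y; ∣⁅x⁆∣≡1; x∈p∪q⁺; x∈p∪q⁻
        ; x∈p∧x∉q⇒x∈p─q; p─q⊆p; x∉p⇒x∈∁p; x∈∁p⇒x∉p; p⊆q⇒∣p∣≤∣q∣; x∈p⇒∣p-x∣<∣p∣; ∈⊤ )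
open import Data.Rational using (ℚ; mkℚ; 0ℚ; 1ℚ; ½; _/_; _+_; _-_; _*_; _≤_; *≤*)
import Data.Rational.Properties as ℚP
open import Data.Rational.Solver using (module +-*-Solver)
open import Data.Product using (Σ; ∃; _×_; _,_; proj₁; proj₂)
open import Data.Sum using (_⊎_; inj₁; inj₂; [_,_])
open import Function using (_∘_; case_of_)
open import Relation.Unary using (Decidable)
open import Relation.Nullary using (¬_; yes; no; does; contradiction; _×-dec_)
open import Relation.Nullary.Decidable using (dec-true)
open import Algebra.Bundles using (CommutativeMonoid)
import Algebra.Properties.CommutativeSemigroup as CommSemigroupProperties
open import Relation.Binary.PropositionalEquality
  using (_≡_; refl; sym; trans; cong; cong₂; subst; subst₂; module ≡-Reasoning)

module ℕ-comm = CommSemigroupProperties ℕP.+-commutativeSemigroup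
module ℚ-comm = CommSemigroupProperties (CommutativeMonoid.commutativeSemigroup ℚP.+-0-commutativeMonoid)
open +-*-Solver using (solve; _:+_; _:-_; _:*_; _:=_; con)

Disjoint : ∀ {n} → Subset n → Subset n → Set
Disjoint p q = ∀ {x} → x ∈ p → x ∉ q

disjoint-tail : ∀ {n a b} {p q : Subset n} → Disjoint (a ∷ p) (b ∷ q) → Disjoint p q
disjoint-tail d x∈p x∈q = d (there x∈p) (there x∈q)

disjoint-mono : ∀ {n} {p p′ q q′ : Subset n} → p′ ⊆ p → q′ ⊆ q → Disjoint p q → Disjoint p′ q′
disjoint-mono p′⊆p q′⊆q d x∈p′ x∈q′ = d (p′⊆p x∈p′) (q′⊆q x∈q′)

x∈p─q⇒x∉q : ∀ {n} {x : Fin n} (p q : Subset n) → x ∈ p ─ q → x ∉ q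
x∈p─q⇒x∉q (_ ∷ p) (inside ∷ q) () here
x∈p─q⇒x∉q (_ ∷ p) (_ ∷ q) (there x∈p─q) (there x∈q) = x∈p─q⇒x∉q p q x∈p─q x∈q

x∈p⇒⁅x⁆⊆p : ∀ {n} {x : Fin n} {p : Subset n} → x ∈ p → ⁅ x ⁆ ⊆ p
x∈p⇒⁅x⁆⊆p {x = x} {p} x∈p y∈⁅x⁆ = subst (_∈ p) (sym (x∈⁅y⁆⇒x≡y x y∈⁅x⁆)) x∈p

∣p∪q∣≤∣p∣+∣q∣ : ∀ {n} (p q : Subset n) → ∣ p ∪ q ∣ ℕ.≤ ∣ p ∣ ℕ.+ ∣ q ∣
∣p∪q∣≤∣p∣+∣q∣ []            []            = z≤n
∣p∪q∣≤∣p∣+∣q∣ (inside ∷ p)  (inside ∷ q)  =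
  s≤s (ℕP.≤-trans (∣p∪q∣≤∣p∣+∣q∣ p q) (ℕP.+-monoʳ-≤ ∣ p ∣ (ℕP.n≤1+n ∣ q ∣)))
∣p∪q∣≤∣p∣+∣q∣ (inside ∷ p)  (outside ∷ q) = s≤s (∣p∪q∣≤∣p∣+∣q∣ p q)
∣p∪q∣≤∣p∣+∣q∣ (outside ∷ p) (inside ∷ q)  =
  subst (suc ∣ p ∪ q ∣ ℕ.≤_) (sym (ℕP.+-suc ∣ p ∣ ∣ q ∣)) (s≤s (∣p∪q∣≤∣p∣+∣q∣ p q))
∣p∪q∣≤∣p∣+∣q∣ (outside ∷ p) (outside ∷ q) = ∣p∪q∣≤∣p∣+∣q∣ p q

∣p∪q∣≡∣p∣+∣q∣ : ∀ {n} (p q : Subset n) → Disjoint p q → ∣ p ∪ q ∣ ≡ ∣ p ∣ ℕ.+ ∣ q ∣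
∣p∪q∣≡∣p∣+∣q∣ []            []            d = refl
∣p∪q∣≡∣p∣+∣q∣ (inside ∷ p)  (inside ∷ q)  d = contradiction here (d here)
∣p∪q∣≡∣p∣+∣q∣ (inside ∷ p)  (outside ∷ q) d = cong suc (∣p∪q∣≡∣p∣+∣q∣ p q (disjoint-tail d))
∣p∪q∣≡∣p∣+∣q∣ (outside ∷ p) (inside ∷ q)  d =
  trans (cong suc (∣p∪q∣≡∣p∣+∣q∣ p q (disjoint-tail d))) (sym (ℕP.+-suc ∣ p ∣ ∣ q ∣))
∣p∪q∣≡∣p∣+∣q∣ (outside ∷ p) (outside ∷ q) d = ∣p∪q∣≡∣p∣+∣q∣ p q (disjoint-tail d)

∣p─q∣+∣q∣≡∣p∣ : ∀ {n} (p q : Subset n) → q ⊆ p → ∣ p ─ q ∣ ℕ.+ ∣ q ∣ ≡ ∣ p ∣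
∣p─q∣+∣q∣≡∣p∣ []            []            q⊆p = refl
∣p─q∣+∣q∣≡∣p∣ (inside ∷ p)  (inside ∷ q)  q⊆p =
  trans (ℕP.+-suc ∣ p ─ q ∣ ∣ q ∣) (cong suc (∣p─q∣+∣q∣≡∣p∣ p q (drop-∷-⊆ q⊆p)))
∣p─q∣+∣q∣≡∣p∣ (inside ∷ p)  (outside ∷ q) q⊆p = cong suc (∣p─q∣+∣q∣≡∣p∣ p q (drop-∷-⊆ q⊆p))
∣p─q∣+∣q∣≡∣p∣ (outside ∷ p) (inside ∷ q)  q⊆p with q⊆p here
... | ()
∣p─q∣+∣q∣≡∣p∣ (outside ∷ p) (outside ∷ q) q⊆p = ∣p─q∣+∣q∣≡∣p∣ p q (drop-∷-⊆ q⊆p)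

0<∣p∣⇒Nonempty : ∀ {n} (p : Subset n) → 0 ℕ.< ∣ p ∣ → Nonempty p
0<∣p∣⇒Nonempty {n} p 0<∣p∣ with nonempty? p
... | yes ne = ne
... | no  e  = contradiction (trans (cong ∣_∣ (Empty-unique e)) (∣⊥∣≡0 n)) (ℕP.n>0⇒n≢0 0<∣p∣)

argmax : ∀ {n} (f : Subset n → ℕ) (C : Subset n) →
         Σ (Subset n) λ T → T ⊆ C × (∀ T′ → T′ ⊆ C → f T′ ℕ.≤ f T)
argmax f [] = [] , ⊆-refl , λ { [] _ → ℕP.≤-refl }
argmax f (outside ∷ C) with argmax (f ∘ (outside ∷_)) C
... | T , T⊆C , max = outside ∷ T , out⊆ T⊆C , λ
  { (inside ∷ T′)  T′⊆ → contradiction (T′⊆ here) λ ()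
  ; (outside ∷ T′) T′⊆ → max T′ (drop-∷-⊆ T′⊆) }
argmax f (inside ∷ C) with argmax (f ∘ (inside ∷_)) C | argmax (f ∘ (outside ∷_)) C
... | Tᵢ , Tᵢ⊆C , maxᵢ | Tₒ , Tₒ⊆C , maxₒ with f (inside ∷ Tᵢ) ℕ.≤? f (outside ∷ Tₒ)
...   | yes fᵢ≤fₒ = outside ∷ Tₒ , out⊆ Tₒ⊆C , λ
  { (inside ∷ T′)  T′⊆ → ℕP.≤-trans (maxᵢ T′ (drop-∷-⊆ T′⊆)) fᵢ≤fₒ
  ; (outside ∷ T′) T′⊆ → maxₒ T′ (drop-∷-⊆ T′⊆) }
...   | no  fᵢ≰fₒ = inside ∷ Tᵢ , s⊆s Tᵢ⊆C , λ
  { (inside ∷ T′)  T′⊆ → maxᵢ T′ (drop-∷-⊆ T′⊆)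
  ; (outside ∷ T′) T′⊆ → ℕP.≤-trans (maxₒ T′ (drop-∷-⊆ T′⊆)) (ℕP.≰⇒≥ fᵢ≰fₒ) }

⟦_⟧ : ∀ {n} {P : Fin n → Set} → Decidable P → Subset n
⟦ P? ⟧ = tabulate (does ∘ P?)

∈⟦⟧⁺ : ∀ {n} {P : Fin n → Set} (P? : Decidable P) {x} → P x → x ∈ ⟦ P? ⟧
∈⟦⟧⁺ P? {x} px = VecP.lookup⇒[]= x _ (trans (VecP.lookup∘tabulate _ x) (dec-true (P? x) px))

∈⟦⟧⁻ : ∀ {n} {P : Fin n → Set} (P? : Decidable P) {x} → x ∈ ⟦ P? ⟧ → P x
∈⟦⟧⁻ P? {x} x∈ with P? x | trans (sym (VecP.lookup∘tabulate (does ∘ P?) x)) (VecP.[]=⇒lookup x∈)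
... | yes px | _ = px
... | no _   | ()

ℕ→ℚ-mkℚ : ∀ m → ℕ→ℚ m ≡ mkℚ (ℤ.+ m) 0 (Coprimality.sym (Coprimality.1-coprimeTo m))
ℕ→ℚ-mkℚ m = ℚP.normalize-coprime (Coprimality.sym (Coprimality.1-coprimeTo m))

ℕ→ℚ-+ : ∀ m n → ℕ→ℚ (m ℕ.+ n) ≡ ℕ→ℚ m + ℕ→ℚ n
ℕ→ℚ-+ m n = begin
  ℤ.+ (m ℕ.+ n) / 1
    ≡⟨ cong (λ i → i / 1) (cong₂ ℤ._+_ (sym (ℤP.*-identityʳ (ℤ.+ m))) (sym (ℤP.*-identityʳ (ℤ.+ n)))) ⟩
  ((ℤ.+ m) ℤ.* (ℤ.+ 1) ℤ.+ (ℤ.+ n) ℤ.* (ℤ.+ 1)) / 1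
    ≡⟨ cong₂ _+_ (ℕ→ℚ-mkℚ m) (ℕ→ℚ-mkℚ n) ⟨
  ℕ→ℚ m + ℕ→ℚ n
    ∎
  where open ≡-Reasoning

ℕ→ℚ-mono : ∀ {m n} → m ℕ.≤ n → ℕ→ℚ m ≤ ℕ→ℚ n
ℕ→ℚ-mono {m} {n} m≤n rewrite ℕ→ℚ-mkℚ m | ℕ→ℚ-mkℚ n =
  *≤* (ℤP.*-monoʳ-≤-nonNeg (ℤ.+ 1) (ℤ.+≤+ m≤n))

ℕ→ℚ-cancel : ∀ {m n} → ℕ→ℚ m ≤ ℕ→ℚ n → m ℕ.≤ n
ℕ→ℚ-cancel {m} {n} le rewrite ℕ→ℚ-mkℚ m | ℕ→ℚ-mkℚ n =
  ℤ.drop‿+≤+ (subst₂ ℤ._≤_ (ℤP.*-identityʳ (ℤ.+ m)) (ℤP.*-identityʳ (ℤ.+ n)) (ℚP.drop-*≤* le))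

sumOver : ∀ {n} → Subset n → (Fin n → ℚ) → ℚ
sumOver []            f = 0ℚ
sumOver (inside ∷ S)  f = f F.zero + sumOver S (f ∘ F.suc)
sumOver (outside ∷ S) f = sumOver S (f ∘ F.suc)

Σℚ-supported : ∀ {n} (S : Subset n) (g f : Fin n → ℚ) →
               (∀ v → v ∈ S → g v ≡ f v) → (∀ v → v ∉ S → g v ≡ 0ℚ) →
               Σℚ g ≡ sumOver S f
Σℚ-supported []            g f on off = refl
Σℚ-supported (inside ∷ S)  g f on off =
  cong₂ _+_ (on F.zero here)
    (Σℚ-supported S _ _ (λ v → on (F.suc v) ∘ there) (λ v v∉S → off (F.suc v) (v∉S ∘ drop-there)))
Σℚ-supported (outside ∷ S) g f on off = begin
  g F.zero + Σℚ (g ∘ F.suc)  ≡⟨ cong (_+ Σℚ (g ∘ F.suc)) (off F.zero λ ()) ⟩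
  0ℚ + Σℚ (g ∘ F.suc)        ≡⟨ ℚP.+-identityˡ _ ⟩
  Σℚ (g ∘ F.suc)             ≡⟨ Σℚ-supported S _ _ (λ v → on (F.suc v) ∘ there)
                                                     (λ v v∉S → off (F.suc v) (v∉S ∘ drop-there)) ⟩
  sumOver S (f ∘ F.suc)      ∎
  where open ≡-Reasoning

-- The summand of lpValue S x (a case split on v ∈? S local to its definition),
-- named through the defining equation of lpValue.
lpSummand : ∀ {n} (S : Subset n) (x : Fin n → ℚ) → Σ (Fin n → ℚ) λ g → lpValue S x ≡ Σℚ g
lpSummand S x = _ , refl

lpValue≡sumOver : ∀ {n} (S : Subset n) (x : Fin n → ℚ) → lpValue S x ≡ sumOver S x
lpValue≡sumOver S x = trans (proj₂ (lpSummand S x)) (Σℚ-supported S (proj₁ (lpSummand S x)) x on off)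
  where
  on : ∀ v → v ∈ S → proj₁ (lpSummand S x) v ≡ x v
  on v v∈S with v ∈? S
  ... | yes _   = refl
  ... | no v∉S = contradiction v∈S v∉S
  off : ∀ v → v ∉ S → proj₁ (lpSummand S x) v ≡ 0ℚ
  off v v∉S with v ∈? S
  ... | yes v∈S = contradiction v∈S v∉S
  ... | no _    = refl

sumOver-nonneg : ∀ {n} (S : Subset n) (f : Fin n → ℚ) → (∀ v → v ∈ S → 0ℚ ≤ f v) → 0ℚ ≤ sumOver S f
sumOver-nonneg []            f f≥0 = ℚP.≤-refl
sumOver-nonneg (inside ∷ S)  f f≥0 =
  ℚP.+-mono-≤ (f≥0 F.zero here) (sumOver-nonneg S _ (λ v → f≥0 (F.suc v) ∘ there))
sumOver-nonneg (outside ∷ S) f f≥0 = sumOver-nonneg S _ (λ v → f≥0 (F.suc v) ∘ there)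

sumOver-mono : ∀ {n} (S S′ : Subset n) (f : Fin n → ℚ) → S ⊆ S′ →
               (∀ v → v ∈ S′ → 0ℚ ≤ f v) → sumOver S f ≤ sumOver S′ f
sumOver-mono []            []             f S⊆S′ f≥0 = ℚP.≤-refl
sumOver-mono (inside ∷ S)  (inside ∷ S′)  f S⊆S′ f≥0 =
  ℚP.+-monoʳ-≤ (f F.zero) (sumOver-mono S S′ _ (drop-∷-⊆ S⊆S′) (λ v → f≥0 (F.suc v) ∘ there))
sumOver-mono (inside ∷ S)  (outside ∷ S′) f S⊆S′ f≥0 with S⊆S′ here
... | ()
sumOver-mono (outside ∷ S) (inside ∷ S′)  f S⊆S′ f≥0 =
  subst (_≤ _) (ℚP.+-identityˡ _)
    (ℚP.+-mono-≤ (f≥0 F.zero here) (sumOver-mono S S′ _ (drop-∷-⊆ S⊆S′) (λ v → f≥0 (F.suc v) ∘ there)))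
sumOver-mono (outside ∷ S) (outside ∷ S′) f S⊆S′ f≥0 =
  sumOver-mono S S′ _ (drop-∷-⊆ S⊆S′) (λ v → f≥0 (F.suc v) ∘ there)

sumOver-cong : ∀ {n} (S : Subset n) {f g : Fin n → ℚ} → (∀ v → f v ≡ g v) → sumOver S f ≡ sumOver S g
sumOver-cong []            f≡g = refl
sumOver-cong (inside ∷ S)  f≡g = cong₂ _+_ (f≡g F.zero) (sumOver-cong S (f≡g ∘ F.suc))
sumOver-cong (outside ∷ S) f≡g = sumOver-cong S (f≡g ∘ F.suc)

sumOver-∪ : ∀ {n} (S T : Subset n) (f : Fin n → ℚ) → Disjoint S T →
            sumOver (S ∪ T) f ≡ sumOver S f + sumOver T f
sumOver-∪ []            []            f d = refl
sumOver-∪ (inside ∷ S)  (inside ∷ T)  f d = contradiction here (d here)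
sumOver-∪ (inside ∷ S)  (outside ∷ T) f d =
  trans (cong (f F.zero +_) (sumOver-∪ S T (f ∘ F.suc) (disjoint-tail d)))
        (sym (ℚP.+-assoc (f F.zero) _ _))
sumOver-∪ (outside ∷ S) (inside ∷ T)  f d =
  trans (cong (f F.zero +_) (sumOver-∪ S T (f ∘ F.suc) (disjoint-tail d)))
        (ℚ-comm.x∙yz≈y∙xz (f F.zero) (sumOver S (f ∘ F.suc)) (sumOver T (f ∘ F.suc)))
sumOver-∪ (outside ∷ S) (outside ∷ T) f d = sumOver-∪ S T _ (disjoint-tail d)

sumOver-⊥ : ∀ {n} (f : Fin n → ℚ) → sumOver ⊥ f ≡ 0ℚ
sumOver-⊥ {zero}  f = refl
sumOver-⊥ {suc n} f = sumOver-⊥ {n} (f ∘ F.suc)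

sumOver-⁅⁆ : ∀ {n} (a : Fin n) (f : Fin n → ℚ) → sumOver ⁅ a ⁆ f ≡ f a
sumOver-⁅⁆ {suc n} F.zero f = trans (cong (f F.zero +_) (sumOver-⊥ {n} _)) (ℚP.+-identityʳ _)
sumOver-⁅⁆ (F.suc a)    f = sumOver-⁅⁆ a (f ∘ F.suc)

sumOver-+ : ∀ {n} (S : Subset n) (f g : Fin n → ℚ) →
            sumOver S (λ v → f v + g v) ≡ sumOver S f + sumOver S g
sumOver-+ []            f g = refl
sumOver-+ (inside ∷ S)  f g =
  trans (cong (f F.zero + g F.zero +_) (sumOver-+ S (f ∘ F.suc) (g ∘ F.suc)))
        (ℚ-comm.interchange (f F.zero) (g F.zero) (sumOver S (f ∘ F.suc)) (sumOver S (g ∘ F.suc)))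
sumOver-+ (outside ∷ S) f g = sumOver-+ S _ _

sumOver-* : ∀ {n} (S : Subset n) (c : ℚ) (f : Fin n → ℚ) →
            sumOver S (λ v → c * f v) ≡ c * sumOver S f
sumOver-* []            c f = sym (ℚP.*-zeroʳ c)
sumOver-* (inside ∷ S)  c f =
  trans (cong (c * f F.zero +_) (sumOver-* S c _)) (sym (ℚP.*-distribˡ-+ c _ _))
sumOver-* (outside ∷ S) c f = sumOver-* S c _

χ : ∀ {n} → Subset n → Fin n → ℕ
χ D v = if does (v ∈? D) then 1 else 0

sumOver-χ : ∀ {n} (S D : Subset n) → D ⊆ S → sumOver S (λ v → ℕ→ℚ (χ D v)) ≡ ℕ→ℚ ∣ D ∣
sumOver-χ []            []            D⊆S = refl
sumOver-χ (inside ∷ S)  (inside ∷ D)  D⊆S =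
  trans (cong (1ℚ +_) (sumOver-χ S D (drop-∷-⊆ D⊆S))) (sym (ℕ→ℚ-+ 1 ∣ D ∣))
sumOver-χ (inside ∷ S)  (outside ∷ D) D⊆S =
  trans (cong (0ℚ +_) (sumOver-χ S D (drop-∷-⊆ D⊆S))) (ℚP.+-identityˡ _)
sumOver-χ (outside ∷ S) (inside ∷ D)  D⊆S with D⊆S here
... | ()
sumOver-χ (outside ∷ S) (outside ∷ D) D⊆S = sumOver-χ S D (drop-∷-⊆ D⊆S)

χ-∈ : ∀ {n} {D : Subset n} {v} → v ∈ D → χ D v ≡ 1
χ-∈ {D = D} {v} v∈D with v ∈? D
... | yes _   = refl
... | no v∉D = contradiction v∈D v∉D

χ≤1 : ∀ {n} (D : Subset n) v → χ D v ℕ.≤ 1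
χ≤1 D v with does (v ∈? D)
... | true  = s≤s z≤n
... | false = z≤n

module _ {n : ℕ} (G : Graph n) where

  Edge : Fin n → Fin n → Set
  Edge u v = adj G u v ≡ true

  edge-sym : ∀ {u v} → Edge u v → Edge v u
  edge-sym {u} {v} e = trans (adj-sym G v u) e

  edge-irr : ∀ {u} → ¬ Edge u u
  edge-irr {u} e with trans (sym e) (adj-irr G u)
  ... | ()

  InNbhd : Subset n → Subset n → Fin n → Set
  InNbhd T B v = v ∈ B × ∃ λ t → t ∈ T × Edge t v

  inNbhd? : ∀ T B → Decidable (InNbhd T B)
  inNbhd? T B v = v ∈? B ×-dec FinP.any? (λ t → t ∈? T ×-dec adj G t v Bool.≟ true)

  nbhd : Subset n → Subset n → Subset n
  nbhd T B = ⟦ inNbhd? T B ⟧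

  ∈nbhd⁺ : ∀ {T B t v} → v ∈ B → t ∈ T → Edge t v → v ∈ nbhd T B
  ∈nbhd⁺ {T} {B} {t} v∈B t∈T e = ∈⟦⟧⁺ (inNbhd? T B) (v∈B , t , t∈T , e)

  ∈nbhd⁻ : ∀ {T B v} → v ∈ nbhd T B → InNbhd T B v
  ∈nbhd⁻ {T} {B} = ∈⟦⟧⁻ (inNbhd? T B)

  nbhd⊆ : ∀ T B → nbhd T B ⊆ B
  nbhd⊆ T B = proj₁ ∘ ∈nbhd⁻

  -- y is a fractional vertex cover of G[S].
  FractionalCover : Subset n → (Fin n → ℚ) → Set
  FractionalCover S y =
    (∀ v → v ∈ S → 0ℚ ≤ y v) × (∀ u v → u ∈ S → v ∈ S → Edge u v → 1ℚ ≤ y u + y v)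

  fractionalCover-mono : ∀ {S S′ y} → S ⊆ S′ → FractionalCover S′ y → FractionalCover S y
  fractionalCover-mono S⊆S′ (y≥0 , y-edge) =
    (λ v → y≥0 v ∘ S⊆S′) , (λ u v u∈ v∈ → y-edge u v (S⊆S′ u∈) (S⊆S′ v∈))

  -- FracLB S m: every fractional vertex cover of G[S] has value at least m.
  -- It is certified below by packing vertex-disjoint edges into S.
  record FracLB (S : Subset n) (m : ℕ) : Set where
    constructor fracLB
    field bound : ∀ y → FractionalCover S y → ℕ→ℚ m ≤ sumOver S y
  open FracLB public

  fracLB-zero : ∀ S → FracLB S 0
  fracLB-zero S = fracLB λ y (y≥0 , _) → sumOver-nonneg S y y≥0

  fracLB-mono : ∀ {S S′ m} → S ⊆ S′ → FracLB S m → FracLB S′ m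
  fracLB-mono {S} {S′} S⊆S′ lb = fracLB λ y cover@(y≥0 , _) →
    ℚP.≤-trans (bound lb y (fractionalCover-mono S⊆S′ cover)) (sumOver-mono S S′ y S⊆S′ y≥0)

  fracLB-∪ : ∀ {S T m k} → Disjoint S T → FracLB S m → FracLB T k → FracLB (S ∪ T) (m ℕ.+ k)
  fracLB-∪ {S} {T} {m} {k} S#T lbS lbT = fracLB λ y cover →
    subst₂ _≤_ (sym (ℕ→ℚ-+ m k)) (sym (sumOver-∪ S T y S#T))
      (ℚP.+-mono-≤ (bound lbS y (fractionalCover-mono (x∈p∪q⁺ ∘ inj₁) cover))
                   (bound lbT y (fractionalCover-mono (x∈p∪q⁺ ∘ inj₂) cover)))

  fracLB-edge : ∀ {a b} → Edge a b → FracLB (⁅ a ⁆ ∪ ⁅ b ⁆) 1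
  fracLB-edge {a} {b} e = fracLB λ y (_ , y-edge) →
    subst (1ℚ ≤_) (sym (trans (sumOver-∪ ⁅ a ⁆ ⁅ b ⁆ y a≠b) (cong₂ _+_ (sumOver-⁅⁆ a y) (sumOver-⁅⁆ b y))))
      (y-edge a b (x∈p∪q⁺ (inj₁ (x∈⁅x⁆ a))) (x∈p∪q⁺ (inj₂ (x∈⁅x⁆ b))) e)
    where
    a≠b : Disjoint ⁅ a ⁆ ⁅ b ⁆
    a≠b x∈a x∈b with x∈⁅y⁆⇒x≡y a x∈a | x∈⁅y⁆⇒x≡y b x∈b
    ... | refl | refl = edge-irr e

  nbhd-─ : ∀ S B P → nbhd S B ⊆ nbhd S (B ─ P) ∪ P
  nbhd-─ S B P {v} v∈N with v ∈? P | ∈nbhd⁻ v∈N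
  ... | yes v∈P | _                  = x∈p∪q⁺ (inj₂ v∈P)
  ... | no  v∉P | v∈B , t , t∈S , e = x∈p∪q⁺ (inj₁ (∈nbhd⁺ (x∈p∧x∉q⇒x∈p─q v∈B v∉P) t∈S e))

  nbhd-∪ : ∀ S T B → nbhd (S ∪ T) B ⊆ nbhd S (B ─ nbhd T B) ∪ nbhd T B
  nbhd-∪ S T B {v} v∈N with v ∈? nbhd T B | ∈nbhd⁻ v∈N
  ... | yes v∈NT | _ = x∈p∪q⁺ (inj₂ v∈NT)
  ... | no  v∉NT | v∈B , t , t∈S∪T , e with x∈p∪q⁻ S T t∈S∪T
  ...   | inj₁ t∈S = x∈p∪q⁺ (inj₁ (∈nbhd⁺ (x∈p∧x∉q⇒x∈p─q v∈B v∉NT) t∈S e))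
  ...   | inj₂ t∈T = contradiction (∈nbhd⁺ v∈B t∈T e) v∉NT

  nbhd-mono : ∀ {S T} B → S ⊆ T → nbhd S B ⊆ nbhd T B
  nbhd-mono B S⊆T v∈N with ∈nbhd⁻ v∈N
  ... | v∈B , t , t∈S , e = ∈nbhd⁺ v∈B (S⊆T t∈S) e

  nbhd-within : ∀ {S T} B → S ⊆ T → nbhd S B ⊆ nbhd S (nbhd T B)
  nbhd-within B S⊆T v∈N with ∈nbhd⁻ v∈N
  ... | v∈B , t , t∈S , e = ∈nbhd⁺ (∈nbhd⁺ v∈B (S⊆T t∈S) e) t∈S e

  HallCondition : Subset n → Subset n → Set
  HallCondition A B = ∀ T → T ⊆ A → ∣ T ∣ ℕ.≤ ∣ nbhd T B ∣

  -- The dual trace of a matching saturating A inside B: the matched partners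
  -- B′ ⊆ B, as many as A, such that G[A ∪ B′] has no fractional vertex cover
  -- of value below ∣ A ∣ (the matching edges are disjoint and each needs 1).
  record Saturation (A B : Subset n) : Set where
    field
      partners   : Subset n
      partners⊆  : partners ⊆ B
      ∣partners∣ : ∣ partners ∣ ≡ ∣ A ∣
      lowerBound : FracLB (A ∪ partners) ∣ A ∣

  saturation-empty : ∀ {A B} → ∣ A ∣ ≡ 0 → Saturation A B
  saturation-empty {A} ∣A∣≡0 = record
    { partners   = ⊥
    ; partners⊆  = λ x∈⊥ → contradiction x∈⊥ ∉⊥
    ; ∣partners∣ = trans (∣⊥∣≡0 n) (sym ∣A∣≡0)
    ; lowerBound = subst (FracLB (A ∪ ⊥)) (sym ∣A∣≡0) (fracLB-zero (A ∪ ⊥))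
    }

  saturation-edge : ∀ {c i} → Edge c i → Saturation ⁅ c ⁆ ⁅ i ⁆
  saturation-edge {c} {i} e = record
    { partners   = ⁅ i ⁆
    ; partners⊆  = ⊆-refl
    ; ∣partners∣ = trans (∣⁅x⁆∣≡1 i) (sym (∣⁅x⁆∣≡1 c))
    ; lowerBound = subst (FracLB (⁅ c ⁆ ∪ ⁅ i ⁆)) (sym (∣⁅x⁆∣≡1 c)) (fracLB-edge e)
    }

  saturation-split : ∀ {A B A₁ P} → Disjoint A B → A₁ ⊆ A → P ⊆ B →
                     Saturation A₁ P → Saturation (A ─ A₁) (B ─ P) → Saturation A B
  saturation-split {A} {B} {A₁} {P} A#B A₁⊆A P⊆B s₁ s₂ = record
    { partners   = B₁ ∪ B₂
    ; partners⊆  = λ x∈ → [ P⊆B ∘ B₁⊆P , p─q⊆p B P ∘ B₂⊆ ] (x∈p∪q⁻ B₁ B₂ x∈)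
    ; ∣partners∣ = begin
        ∣ B₁ ∪ B₂ ∣            ≡⟨ ∣p∪q∣≡∣p∣+∣q∣ B₁ B₂ B₁#B₂ ⟩
        ∣ B₁ ∣ ℕ.+ ∣ B₂ ∣       ≡⟨ cong₂ ℕ._+_ ∣B₁∣ ∣B₂∣ ⟩
        ∣ A₁ ∣ ℕ.+ ∣ A ─ A₁ ∣   ≡⟨ ∣A₁∣+∣A─A₁∣ ⟩
        ∣ A ∣                   ∎
    ; lowerBound = fracLB-mono inclusion
        (subst (FracLB ((A₁ ∪ B₁) ∪ ((A ─ A₁) ∪ B₂))) ∣A₁∣+∣A─A₁∣
          (fracLB-∪ parts-disjoint lb₁ lb₂))
    }
    where
    open ≡-Reasoning
    open Saturation s₁ renaming (partners to B₁; partners⊆ to B₁⊆P; ∣partners∣ to ∣B₁∣; lowerBound to lb₁)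
    open Saturation s₂ renaming (partners to B₂; partners⊆ to B₂⊆; ∣partners∣ to ∣B₂∣; lowerBound to lb₂)
    ∣A₁∣+∣A─A₁∣ : ∣ A₁ ∣ ℕ.+ ∣ A ─ A₁ ∣ ≡ ∣ A ∣
    ∣A₁∣+∣A─A₁∣ = trans (ℕP.+-comm ∣ A₁ ∣ _) (∣p─q∣+∣q∣≡∣p∣ A A₁ A₁⊆A)
    B₁#B₂ : Disjoint B₁ B₂
    B₁#B₂ x∈B₁ x∈B₂ = x∈p─q⇒x∉q B P (B₂⊆ x∈B₂) (B₁⊆P x∈B₁)
    parts-disjoint : Disjoint (A₁ ∪ B₁) ((A ─ A₁) ∪ B₂)
    parts-disjoint x∈₁ x∈₂ with x∈p∪q⁻ A₁ B₁ x∈₁ | x∈p∪q⁻ (A ─ A₁) B₂ x∈₂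
    ... | inj₁ x∈A₁ | inj₁ x∈A─A₁ = x∈p─q⇒x∉q A A₁ x∈A─A₁ x∈A₁
    ... | inj₁ x∈A₁ | inj₂ x∈B₂   = A#B (A₁⊆A x∈A₁) (p─q⊆p B P (B₂⊆ x∈B₂))
    ... | inj₂ x∈B₁ | inj₁ x∈A─A₁ = A#B (p─q⊆p A A₁ x∈A─A₁) (P⊆B (B₁⊆P x∈B₁))
    ... | inj₂ x∈B₁ | inj₂ x∈B₂   = B₁#B₂ x∈B₁ x∈B₂
    inclusion : (A₁ ∪ B₁) ∪ ((A ─ A₁) ∪ B₂) ⊆ A ∪ (B₁ ∪ B₂)
    inclusion x∈ with x∈p∪q⁻ (A₁ ∪ B₁) _ x∈
    ... | inj₁ x∈₁ = x∈p∪q⁺ ([ inj₁ ∘ A₁⊆A , inj₂ ∘ x∈p∪q⁺ ∘ inj₁ ] (x∈p∪q⁻ A₁ B₁ x∈₁))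
    ... | inj₂ x∈₂ = x∈p∪q⁺ ([ inj₁ ∘ p─q⊆p A A₁ , inj₂ ∘ x∈p∪q⁺ ∘ inj₂ ] (x∈p∪q⁻ (A ─ A₁) B₂ x∈₂))

  Tight : Subset n → Subset n → Subset n → Set
  Tight A B T = T ⊆ A × 0 ℕ.< ∣ T ∣ × ∣ T ∣ ℕ.< ∣ A ∣ × ∣ nbhd T B ∣ ℕ.≤ ∣ T ∣

  tight? : ∀ A B → Decidable (Tight A B)
  tight? A B T = T ⊆? A ×-dec 0 ℕ.<? ∣ T ∣ ×-dec ∣ T ∣ ℕ.<? ∣ A ∣ ×-dec ∣ nbhd T B ∣ ℕ.≤? ∣ T ∣

  hall-inside : ∀ {A B T} → T ⊆ A → HallCondition A B → HallCondition T (nbhd T B)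
  hall-inside {B = B} T⊆A hallAB S S⊆T =
    ℕP.≤-trans (hallAB S (T⊆A ∘ S⊆T)) (p⊆q⇒∣p∣≤∣q∣ (nbhd-within B S⊆T))

  hall-outside : ∀ {A B T} → T ⊆ A → ∣ nbhd T B ∣ ℕ.≤ ∣ T ∣ →
                 HallCondition A B → HallCondition (A ─ T) (B ─ nbhd T B)
  hall-outside {A} {B} {T} T⊆A T-tight hallAB S S⊆A─T = ℕP.+-cancelʳ-≤ (∣ T ∣) (∣ S ∣) (∣ nbhd S B′ ∣) (begin
    ∣ S ∣ ℕ.+ ∣ T ∣                       ≡⟨ ∣p∪q∣≡∣p∣+∣q∣ S T S#T ⟨
    ∣ S ∪ T ∣                             ≤⟨ hallAB (S ∪ T) S∪T⊆A ⟩
    ∣ nbhd (S ∪ T) B ∣                    ≤⟨ p⊆q⇒∣p∣≤∣q∣ (nbhd-∪ S T B) ⟩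
    ∣ nbhd S B′ ∪ nbhd T B ∣              ≤⟨ ∣p∪q∣≤∣p∣+∣q∣ (nbhd S B′) (nbhd T B) ⟩
    ∣ nbhd S B′ ∣ ℕ.+ ∣ nbhd T B ∣        ≤⟨ ℕP.+-monoʳ-≤ ∣ nbhd S B′ ∣ T-tight ⟩
    ∣ nbhd S B′ ∣ ℕ.+ ∣ T ∣               ∎)
    where
    open ℕP.≤-Reasoning
    B′ : Subset n
    B′ = B ─ nbhd T B
    S#T : Disjoint S T
    S#T x∈S = x∈p─q⇒x∉q A T (S⊆A─T x∈S)
    S∪T⊆A : S ∪ T ⊆ A
    S∪T⊆A x∈ = [ p─q⊆p A T ∘ S⊆A─T , T⊆A ] (x∈p∪q⁻ S T x∈)

  hall-untight : ∀ {A B c i} → ¬ ∃ (Tight A B) → c ∈ A →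
                 HallCondition A B → HallCondition (A ─ ⁅ c ⁆) (B ─ ⁅ i ⁆)
  hall-untight {A} {B} {c} {i} untight c∈A hallAB S S⊆A─c with 0 ℕ.<? ∣ S ∣
  ... | no  ∣S∣≯0 = ℕP.≤-trans (ℕP.≮⇒≥ ∣S∣≯0) z≤n
  ... | yes ∣S∣>0 = ℕP.+-cancelʳ-≤ 1 (∣ S ∣) (∣ nbhd S (B ─ ⁅ i ⁆) ∣) (begin
    ∣ S ∣ ℕ.+ 1                           ≡⟨ ℕP.+-comm ∣ S ∣ 1 ⟩
    suc ∣ S ∣                             ≤⟨ ℕP.≰⇒> (λ few → untight (S , S⊆A , ∣S∣>0 , ∣S∣<∣A∣ , few)) ⟩
    ∣ nbhd S B ∣                          ≤⟨ p⊆q⇒∣p∣≤∣q∣ (nbhd-─ S B ⁅ i ⁆) ⟩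
    ∣ nbhd S (B ─ ⁅ i ⁆) ∪ ⁅ i ⁆ ∣        ≤⟨ ∣p∪q∣≤∣p∣+∣q∣ (nbhd S (B ─ ⁅ i ⁆)) ⁅ i ⁆ ⟩
    ∣ nbhd S (B ─ ⁅ i ⁆) ∣ ℕ.+ ∣ ⁅ i ⁆ ∣  ≡⟨ cong (∣ nbhd S (B ─ ⁅ i ⁆) ∣ ℕ.+_) (∣⁅x⁆∣≡1 i) ⟩
    ∣ nbhd S (B ─ ⁅ i ⁆) ∣ ℕ.+ 1          ∎)
    where
    open ℕP.≤-Reasoning
    S⊆A : S ⊆ A
    S⊆A = p─q⊆p A ⁅ c ⁆ ∘ S⊆A─c
    ∣S∣<∣A∣ : ∣ S ∣ ℕ.< ∣ A ∣
    ∣S∣<∣A∣ = ℕP.≤-<-trans (p⊆q⇒∣p∣≤∣q∣ S⊆A─c) (x∈p⇒∣p-x∣<∣p∣ c∈A)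

  -- By induction on ∣ A ∣ (bounded by f): split A along a
  -- tight set if there is one; otherwise match some c ∈ A to a neighbour i,
  -- which keeps Hall's condition for the rest.
  hall : ∀ f {A B} → ∣ A ∣ ℕ.≤ f → Disjoint A B → HallCondition A B → Saturation A B
  hall f {A} ∣A∣≤f A#B hallAB with nonempty? A
  ... | no A-empty = saturation-empty (trans (cong ∣_∣ (Empty-unique A-empty)) (∣⊥∣≡0 n))
  hall zero    ∣A∣≤0 A#B hallAB | yes (c , c∈A) with ℕP.<-≤-trans (x∈p⇒∣p-x∣<∣p∣ c∈A) ∣A∣≤0
  ... | ()
  hall (suc f) {A} {B} ∣A∣≤1+f A#B hallAB | yes (c , c∈A) with anySubset? (tight? A B)
  ... | yes (T , T⊆A , ∣T∣>0 , ∣T∣<∣A∣ , T-tight) =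
    saturation-split A#B T⊆A (nbhd⊆ T B)
      (hall f (smaller ∣T∣<∣A∣) (disjoint-mono T⊆A (nbhd⊆ T B) A#B) (hall-inside T⊆A hallAB))
      (hall f (smaller ∣A─T∣<∣A∣) (disjoint-mono (p─q⊆p A T) (p─q⊆p B _) A#B)
                                    (hall-outside T⊆A T-tight hallAB))
    where
    smaller : ∀ {m} → m ℕ.< ∣ A ∣ → m ℕ.≤ f
    smaller m<∣A∣ = ℕP.m<1+n⇒m≤n (ℕP.<-≤-trans m<∣A∣ ∣A∣≤1+f)
    ∣A─T∣<∣A∣ : ∣ A ─ T ∣ ℕ.< ∣ A ∣
    ∣A─T∣<∣A∣ = subst (∣ A ─ T ∣ ℕ.<_) (∣p─q∣+∣q∣≡∣p∣ A T T⊆A) (ℕP.m<m+n ∣ A ─ T ∣ ∣T∣>0)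
  ... | no untight with 0<∣p∣⇒Nonempty (nbhd ⁅ c ⁆ B) c-has-neighbours
    where
    c-has-neighbours : 0 ℕ.< ∣ nbhd ⁅ c ⁆ B ∣
    c-has-neighbours = subst (ℕ._≤ ∣ nbhd ⁅ c ⁆ B ∣) (∣⁅x⁆∣≡1 c) (hallAB ⁅ c ⁆ (x∈p⇒⁅x⁆⊆p c∈A))
  ...   | i , i∈N with ∈nbhd⁻ i∈N
  ...     | i∈B , c′ , c′∈⁅c⁆ , e with x∈⁅y⁆⇒x≡y c c′∈⁅c⁆
  ...       | refl =
    saturation-split A#B (x∈p⇒⁅x⁆⊆p c∈A) (x∈p⇒⁅x⁆⊆p i∈B) (saturation-edge e)
      (hall f (ℕP.m<1+n⇒m≤n (ℕP.<-≤-trans (x∈p⇒∣p-x∣<∣p∣ c∈A) ∣A∣≤1+f))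
              (disjoint-mono (p─q⊆p A ⁅ c ⁆) (p─q⊆p B ⁅ i ⁆) A#B)
              (hall-untight untight c∈A hallAB))

  -- The surplus ∣ T ∣ + ∣ I ─ nbhd T I ∣ of T measures ∣ T ∣ − ∣ nbhd T I ∣
  -- (shifted by ∣ I ∣ to stay in ℕ).  MaxSurplus C I T: T maximises it
  -- among the subsets of C.
  surplus : Subset n → Subset n → ℕ
  surplus I T = ∣ T ∣ ℕ.+ ∣ I ─ nbhd T I ∣

  MaxSurplus : Subset n → Subset n → Subset n → Set
  MaxSurplus C I T = T ⊆ C × (∀ T′ → T′ ⊆ C → surplus I T′ ℕ.≤ surplus I T)

  -- Maximality of T yields Hall's condition for C ─ T into I ─ nbhd T I:
  -- adding S to T would otherwise increase the surplus.
  hall-beside-max : ∀ {C I T} → MaxSurplus C I T → HallCondition (C ─ T) (I ─ nbhd T I)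
  hall-beside-max {C} {I} {T} (T⊆C , max) S S⊆C─T =
    ℕP.+-cancelʳ-≤ (∣ T ∣ ℕ.+ r) (∣ S ∣) (∣ nbhd S I′ ∣) (begin
      ∣ S ∣ ℕ.+ (∣ T ∣ ℕ.+ r)          ≡⟨ ℕP.+-assoc ∣ S ∣ ∣ T ∣ r ⟨
      (∣ S ∣ ℕ.+ ∣ T ∣) ℕ.+ r          ≡⟨ cong (ℕ._+ r) (∣p∪q∣≡∣p∣+∣q∣ S T S#T) ⟨
      surplus I (S ∪ T)                ≤⟨ max (S ∪ T) S∪T⊆C ⟩
      ∣ T ∣ ℕ.+ ∣ I′ ∣                 ≤⟨ ℕP.+-monoʳ-≤ ∣ T ∣ lost-neighbours ⟩
      ∣ T ∣ ℕ.+ (r ℕ.+ ∣ nbhd S I′ ∣)  ≡⟨ ℕ-comm.x∙yz≈z∙xy (∣ T ∣) r (∣ nbhd S I′ ∣) ⟩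
      ∣ nbhd S I′ ∣ ℕ.+ (∣ T ∣ ℕ.+ r)  ∎)
    where
    open ℕP.≤-Reasoning
    I′ : Subset n
    I′ = I ─ nbhd T I
    r : ℕ
    r = ∣ I ─ nbhd (S ∪ T) I ∣
    S#T : Disjoint S T
    S#T x∈S = x∈p─q⇒x∉q C T (S⊆C─T x∈S)
    S∪T⊆C : S ∪ T ⊆ C
    S∪T⊆C x∈ = [ p─q⊆p C T ∘ S⊆C─T , T⊆C ] (x∈p∪q⁻ S T x∈)
    I′-split : I′ ⊆ (I ─ nbhd (S ∪ T) I) ∪ nbhd S I′
    I′-split {v} v∈I′ with v ∈? nbhd (S ∪ T) I
    ... | no  v∉N = x∈p∪q⁺ (inj₁ (x∈p∧x∉q⇒x∈p─q (p─q⊆p I _ v∈I′) v∉N))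
    ... | yes v∈N with x∈p∪q⁻ _ _ (nbhd-∪ S T I v∈N)
    ...   | inj₁ v∈NS = x∈p∪q⁺ (inj₂ v∈NS)
    ...   | inj₂ v∈NT = contradiction v∈NT (x∈p─q⇒x∉q I _ v∈I′)
    lost-neighbours : ∣ I′ ∣ ℕ.≤ r ℕ.+ ∣ nbhd S I′ ∣
    lost-neighbours = ℕP.≤-trans (p⊆q⇒∣p∣≤∣q∣ I′-split) (∣p∪q∣≤∣p∣+∣q∣ (I ─ nbhd (S ∪ T) I) (nbhd S I′))

  -- Maximality of T yields Hall's condition for nbhd T I into T: removing
  -- from T the neighbours of U ⊆ nbhd T I frees all of U.
  hall-into-max : ∀ {C I T} → MaxSurplus C I T → HallCondition (nbhd T I) T
  hall-into-max {C} {I} {T} (T⊆C , max) U U⊆NT =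
    ℕP.+-cancelˡ-≤ (∣ T′ ∣ ℕ.+ ∣ I′ ∣) (∣ U ∣) (∣ nbhd U T ∣) (begin
      (∣ T′ ∣ ℕ.+ ∣ I′ ∣) ℕ.+ ∣ U ∣              ≡⟨ ℕP.+-assoc (∣ T′ ∣) (∣ I′ ∣) (∣ U ∣) ⟩
      ∣ T′ ∣ ℕ.+ (∣ I′ ∣ ℕ.+ ∣ U ∣)              ≡⟨ cong (∣ T′ ∣ ℕ.+_) (∣p∪q∣≡∣p∣+∣q∣ I′ U I′#U) ⟨
      ∣ T′ ∣ ℕ.+ ∣ I′ ∪ U ∣                      ≤⟨ ℕP.+-monoʳ-≤ (∣ T′ ∣) (p⊆q⇒∣p∣≤∣q∣ freed) ⟩
      surplus I T′                               ≤⟨ max T′ (T⊆C ∘ p─q⊆p T (nbhd U T)) ⟩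
      ∣ T ∣ ℕ.+ ∣ I′ ∣                           ≡⟨ cong (ℕ._+ ∣ I′ ∣) (∣p─q∣+∣q∣≡∣p∣ T (nbhd U T) (nbhd⊆ U T)) ⟨
      (∣ T′ ∣ ℕ.+ ∣ nbhd U T ∣) ℕ.+ ∣ I′ ∣       ≡⟨ ℕ-comm.xy∙z≈xz∙y (∣ T′ ∣) (∣ nbhd U T ∣) (∣ I′ ∣) ⟩
      (∣ T′ ∣ ℕ.+ ∣ I′ ∣) ℕ.+ ∣ nbhd U T ∣       ∎)
    where
    open ℕP.≤-Reasoning
    T′ I′ : Subset n
    T′ = T ─ nbhd U T
    I′ = I ─ nbhd T I
    I′#U : Disjoint I′ U
    I′#U x∈I′ x∈U = x∈p─q⇒x∉q I (nbhd T I) x∈I′ (U⊆NT x∈U)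
    -- no vertex of U, and no vertex outside nbhd T I, is adjacent to T′
    freed : I′ ∪ U ⊆ I ─ nbhd T′ I
    freed {v} x∈ with x∈p∪q⁻ I′ U x∈
    ... | inj₁ v∈I′ = x∈p∧x∉q⇒x∈p─q (p─q⊆p I _ v∈I′)
                        (x∈p─q⇒x∉q I _ v∈I′ ∘ nbhd-mono I (p─q⊆p T (nbhd U T)))
    ... | inj₂ v∈U  = x∈p∧x∉q⇒x∈p─q (nbhd⊆ T I (U⊆NT v∈U)) v∉NT′
      where
      v∉NT′ : v ∉ nbhd T′ I
      v∉NT′ v∈NT′ with ∈nbhd⁻ v∈NT′
      ... | _ , t , t∈T′ , e =
        x∈p─q⇒x∉q T (nbhd U T) t∈T′ (∈nbhd⁺ (p─q⊆p T (nbhd U T) t∈T′) v∈U (edge-sym e))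

  -- For T ⊆ C of maximum surplus w.r.t. a set I disjoint from C, match C ─ T
  -- into I ─ nbhd T I and nbhd T I into T (Hall, twice) and let X be the
  -- unmatched part of T.
  deficiency-removal : ∀ {C I T} → Disjoint C I → MaxSurplus C I T →
    Σ (Subset n) λ X → X ⊆ C × ∣ C ─ X ∣ ≡ ∣ C ─ T ∣ ℕ.+ ∣ nbhd T I ∣ × FracLB (∁ X) ∣ C ─ X ∣
  deficiency-removal {C} {I} {T} C#I maxT@(T⊆C , _) =
    X , X⊆C , ∣C─X∣ , subst (FracLB (∁ X)) (sym ∣C─X∣)
      (fracLB-mono outside-X (fracLB-∪ matchings-disjoint lb₁ lb₂))
    where
    NT : Subset n
    NT = nbhd T I
    s₁ : Saturation (C ─ T) (I ─ NT)
    s₁ = hall _ ℕP.≤-refl (disjoint-mono (p─q⊆p C T) (p─q⊆p I NT) C#I) (hall-beside-max maxT)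
    s₂ : Saturation NT T
    s₂ = hall _ ℕP.≤-refl (λ x∈NT x∈T → C#I (T⊆C x∈T) (nbhd⊆ T I x∈NT)) (hall-into-max maxT)
    open Saturation s₁ renaming (partners to B₁; partners⊆ to B₁⊆; lowerBound to lb₁)
    open Saturation s₂ renaming (partners to T″; partners⊆ to T″⊆T; ∣partners∣ to ∣T″∣; lowerBound to lb₂)
    X : Subset n
    X = T ─ T″
    X⊆C : X ⊆ C
    X⊆C = T⊆C ∘ p─q⊆p T T″
    ∣C─X∣ : ∣ C ─ X ∣ ≡ ∣ C ─ T ∣ ℕ.+ ∣ NT ∣
    ∣C─X∣ = ℕP.+-cancelʳ-≡ (∣ X ∣) (∣ C ─ X ∣) _ (begin
      ∣ C ─ X ∣ ℕ.+ ∣ X ∣                  ≡⟨ ∣p─q∣+∣q∣≡∣p∣ C X X⊆C ⟩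
      ∣ C ∣                                ≡⟨ ∣p─q∣+∣q∣≡∣p∣ C T T⊆C ⟨
      ∣ C ─ T ∣ ℕ.+ ∣ T ∣                  ≡⟨ cong (∣ C ─ T ∣ ℕ.+_) (∣p─q∣+∣q∣≡∣p∣ T T″ T″⊆T) ⟨
      ∣ C ─ T ∣ ℕ.+ (∣ X ∣ ℕ.+ ∣ T″ ∣)     ≡⟨ cong (λ t → ∣ C ─ T ∣ ℕ.+ (∣ X ∣ ℕ.+ t)) ∣T″∣ ⟩
      ∣ C ─ T ∣ ℕ.+ (∣ X ∣ ℕ.+ ∣ NT ∣)     ≡⟨ ℕ-comm.x∙yz≈xz∙y (∣ C ─ T ∣) (∣ X ∣) (∣ NT ∣) ⟩
      (∣ C ─ T ∣ ℕ.+ ∣ NT ∣) ℕ.+ ∣ X ∣     ∎)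
      where open ≡-Reasoning
    matchings-disjoint : Disjoint ((C ─ T) ∪ B₁) (NT ∪ T″)
    matchings-disjoint x∈₁ x∈₂ with x∈p∪q⁻ (C ─ T) B₁ x∈₁ | x∈p∪q⁻ NT T″ x∈₂
    ... | inj₁ x∈C─T | inj₁ x∈NT = C#I (p─q⊆p C T x∈C─T) (nbhd⊆ T I x∈NT)
    ... | inj₁ x∈C─T | inj₂ x∈T″ = x∈p─q⇒x∉q C T x∈C─T (T″⊆T x∈T″)
    ... | inj₂ x∈B₁  | inj₁ x∈NT = x∈p─q⇒x∉q I NT (B₁⊆ x∈B₁) x∈NT
    ... | inj₂ x∈B₁  | inj₂ x∈T″ = C#I (T⊆C (T″⊆T x∈T″)) (p─q⊆p I NT (B₁⊆ x∈B₁))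
    outside-X : ((C ─ T) ∪ B₁) ∪ (NT ∪ T″) ⊆ ∁ X
    outside-X {x} x∈ = x∉p⇒x∈∁p (λ x∈X → x∉X x∈X (x∈p∪q⁻ _ _ x∈))
      where
      x∉X : x ∈ X → ¬ ((x ∈ (C ─ T) ∪ B₁) ⊎ (x ∈ NT ∪ T″))
      x∉X x∈X (inj₁ x∈₁) = [ (λ x∈C─T → x∈p─q⇒x∉q C T x∈C─T (p─q⊆p T T″ x∈X))
                           , (λ x∈B₁ → C#I (X⊆C x∈X) (p─q⊆p I NT (B₁⊆ x∈B₁))) ] (x∈p∪q⁻ _ _ x∈₁)
      x∉X x∈X (inj₂ x∈₂) = [ (λ x∈NT → C#I (X⊆C x∈X) (nbhd⊆ T I x∈NT))
                           , x∈p─q⇒x∉q T T″ x∈X ] (x∈p∪q⁻ _ _ x∈₂)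

  -- For a vertex cover C and any T, the weights 1 on C ─ T, ½ on T ∩ C and on
  -- the outside neighbours nbhd T (∁ C), and 0 elsewhere form a fractional
  -- vertex cover of G; twice its value is ∣ C ∣ + ∣ C ─ T ∣ + ∣ nbhd T (∁ C) ∣.
  half-integral-cover : ∀ {C} T → (∀ u v → Edge u v → u ∈ C ⊎ v ∈ C) →
    Σ (Fin n → ℚ) λ y → IsFractionalVC G ⊤ y
      × sumOver ⊤ y + sumOver ⊤ y ≡ ℕ→ℚ ∣ C ∣ + ℕ→ℚ (∣ C ─ T ∣ ℕ.+ ∣ nbhd T (∁ C) ∣)
  half-integral-cover {C} T cover = y , ((λ v _ → y≥0 v , y≤1 v) , y-edge) , value
    where
    Q : Subset n
    Q = (C ─ T) ∪ nbhd T (∁ C)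
    w : Fin n → ℕ
    w v = χ C v ℕ.+ χ Q v
    y : Fin n → ℚ
    y v = ½ * ℕ→ℚ (w v)
    halve : ∀ k l → k ℕ.≤ l → ½ * ℕ→ℚ k ≤ ½ * ℕ→ℚ l
    halve _ _ k≤l = ℚP.*-monoˡ-≤-nonNeg ½ (ℕ→ℚ-mono k≤l)
    y≥0 : ∀ v → 0ℚ ≤ y v
    y≥0 v = halve 0 (w v) z≤n
    y≤1 : ∀ v → y v ≤ 1ℚ
    y≤1 v = halve (w v) 2 (ℕP.+-mono-≤ (χ≤1 C v) (χ≤1 Q v))
    w-C : ∀ {v} → v ∈ C → 1 ℕ.≤ w v
    w-C {v} v∈C = subst (λ c → 1 ℕ.≤ c ℕ.+ χ Q v) (sym (χ-∈ v∈C)) (s≤s z≤n)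
    w-Q : ∀ {v} → v ∈ Q → 1 ℕ.≤ w v
    w-Q {v} v∈Q = subst (λ q → 1 ℕ.≤ χ C v ℕ.+ q) (sym (χ-∈ v∈Q)) (ℕP.m≤n+m 1 (χ C v))
    w-C─T : ∀ {v} → v ∈ C → v ∉ T → 2 ℕ.≤ w v
    w-C─T {v} v∈C v∉T
      rewrite χ-∈ v∈C | χ-∈ {D = Q} (x∈p∪q⁺ (inj₁ (x∈p∧x∉q⇒x∈p─q v∈C v∉T))) = ℕP.≤-refl
    w-edge : ∀ {u v} → u ∈ C → Edge u v → 2 ℕ.≤ w u ℕ.+ w v
    w-edge {u} {v} u∈C e with u ∈? T
    ... | no  u∉T = ℕP.≤-trans (w-C─T u∈C u∉T) (ℕP.m≤m+n (w u) (w v))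
    ... | yes u∈T = ℕP.+-mono-≤ (w-C u∈C) (case v ∈? C of λ
      { (yes v∈C) → w-C v∈C
      ; (no  v∉C) → w-Q (x∈p∪q⁺ (inj₂ (∈nbhd⁺ (x∉p⇒x∈∁p v∉C) u∈T e))) })
    w-cover : ∀ u v → Edge u v → 2 ℕ.≤ w u ℕ.+ w v
    w-cover u v e with cover u v e
    ... | inj₁ u∈C = w-edge u∈C e
    ... | inj₂ v∈C = subst (2 ℕ.≤_) (ℕP.+-comm (w v) (w u)) (w-edge v∈C (edge-sym e))
    y-edge : ∀ u v → u ∈ ⊤ → v ∈ ⊤ → Edge u v → 1ℚ ≤ y u + y v
    y-edge u v _ _ e =
      subst (1ℚ ≤_) (trans (cong (½ *_) (ℕ→ℚ-+ (w u) (w v))) (ℚP.*-distribˡ-+ ½ (ℕ→ℚ (w u)) (ℕ→ℚ (w v))))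
      (halve 2 (w u ℕ.+ w v) (w-cover u v e))
    Q-parts : Disjoint (C ─ T) (nbhd T (∁ C))
    Q-parts x∈C─T x∈N = x∈∁p⇒x∉p (nbhd⊆ T (∁ C) x∈N) (p─q⊆p C T x∈C─T)
    value : sumOver ⊤ y + sumOver ⊤ y ≡ ℕ→ℚ ∣ C ∣ + ℕ→ℚ (∣ C ─ T ∣ ℕ.+ ∣ nbhd T (∁ C) ∣)
    value = begin
      sumOver ⊤ y + sumOver ⊤ y
        ≡⟨ cong₂ _+_ (sumOver-* ⊤ ½ w′) (sumOver-* ⊤ ½ w′) ⟩
      ½ * W + ½ * W
        ≡⟨ ℚP.*-distribʳ-+ W ½ ½ ⟨
      1ℚ * W
        ≡⟨ ℚP.*-identityˡ W ⟩
      W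
        ≡⟨ sumOver-cong ⊤ (λ v → ℕ→ℚ-+ (χ C v) (χ Q v)) ⟩
      sumOver ⊤ (λ v → ℕ→ℚ (χ C v) + ℕ→ℚ (χ Q v))
        ≡⟨ sumOver-+ ⊤ (ℕ→ℚ ∘ χ C) (ℕ→ℚ ∘ χ Q) ⟩
      sumOver ⊤ (ℕ→ℚ ∘ χ C) + sumOver ⊤ (ℕ→ℚ ∘ χ Q)
        ≡⟨ cong₂ _+_ (sumOver-χ ⊤ C ⊆⊤) (sumOver-χ ⊤ Q ⊆⊤) ⟩
      ℕ→ℚ ∣ C ∣ + ℕ→ℚ ∣ Q ∣
        ≡⟨ cong (λ q → ℕ→ℚ ∣ C ∣ + ℕ→ℚ q) (∣p∪q∣≡∣p∣+∣q∣ (C ─ T) (nbhd T (∁ C)) Q-parts) ⟩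
      ℕ→ℚ ∣ C ∣ + ℕ→ℚ (∣ C ─ T ∣ ℕ.+ ∣ nbhd T (∁ C) ∣)
        ∎
      where
      open ≡-Reasoning
      w′ : Fin n → ℚ
      w′ v = ℕ→ℚ (w v)
      W : ℚ
      W = sumOver ⊤ w′

  indicator-feasible : ∀ {S D} → IsVertexCover G S D → IsFractionalVC G S (ℕ→ℚ ∘ χ D)
  indicator-feasible {S} {D} (_ , D-covers) =
    (λ v _ → ℕ→ℚ-mono (z≤n {χ D v}) , ℕ→ℚ-mono (χ≤1 D v)) ,
    λ u v u∈S v∈S e → subst (1ℚ ≤_) (ℕ→ℚ-+ (χ D u) (χ D v)) (ℕ→ℚ-mono (covered (D-covers u v u∈S v∈S e)))
    where
    covered : ∀ {u v} → u ∈ D ⊎ v ∈ D → 1 ℕ.≤ χ D u ℕ.+ χ D v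
    covered {u} {v} (inj₁ u∈D) = subst (λ c → 1 ℕ.≤ c ℕ.+ χ D v) (sym (χ-∈ u∈D)) (s≤s z≤n)
    covered {u} {v} (inj₂ v∈D) = subst (λ c → 1 ℕ.≤ χ D u ℕ.+ c) (sym (χ-∈ v∈D)) (ℕP.m≤n+m 1 (χ D u))

  integral-optimum : ∀ {S D} → IsVertexCover G S D → FracLB S ∣ D ∣ →
                     IsOPT G S ∣ D ∣ × IsLP G S (ℕ→ℚ ∣ D ∣)
  integral-optimum {S} {D} D-cover lb =
    ((D , D-cover , refl) , λ C C-cover → ℕ→ℚ-cancel (value-of C C-cover ▸ lb-of (indicator-feasible C-cover))) ,
    ((ℕ→ℚ ∘ χ D , indicator-feasible D-cover , trans (lpValue≡sumOver S _) (sumOver-χ S D (proj₁ D-cover))) ,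
     λ x x-feasible → subst (ℕ→ℚ ∣ D ∣ ≤_) (sym (lpValue≡sumOver S x)) (lb-of x-feasible))
    where
    lb-of : ∀ {x} → IsFractionalVC G S x → ℕ→ℚ ∣ D ∣ ≤ sumOver S x
    lb-of {x} (bounds , edges) = bound lb x ((λ v → proj₁ ∘ bounds v) , edges)
    value-of : ∀ C → IsVertexCover G S C → sumOver S (ℕ→ℚ ∘ χ C) ≡ ℕ→ℚ ∣ C ∣
    value-of C (C⊆S , _) = sumOver-χ S C C⊆S
    _▸_ : ∀ {a b c} → b ≡ c → a ≤ b → a ≤ c
    b≡c ▸ a≤b = subst (_ ≤_) b≡c a≤b

  cover-without : ∀ {C} X → (∀ u v → Edge u v → u ∈ C ⊎ v ∈ C) → IsVertexCover G (∁ X) (C ─ X)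
  cover-without {C} X cover =
    (λ x∈C─X → x∉p⇒x∈∁p (x∈p─q⇒x∉q C X x∈C─X)) ,
    λ u v u∈ v∈ e → [ inj₁ ∘ keep u∈ , inj₂ ∘ keep v∈ ] (cover u v e)
    where
    keep : ∀ {x} → x ∈ ∁ X → x ∈ C → x ∈ C ─ X
    keep x∈∁X x∈C = x∈p∧x∉q⇒x∈p─q x∈C (x∈∁p⇒x∉p x∈∁X)

  record Reduction (C : Subset n) : Set where
    field
      X             : Subset n
      ∣X∣+∣C─X∣     : ∣ X ∣ ℕ.+ ∣ C ─ X ∣ ≡ ∣ C ∣
      cover-G─X     : IsVertexCover G (∁ X) (C ─ X)
      lowerBound    : FracLB (∁ X) ∣ C ─ X ∣
      y             : Fin n → ℚ
      y-feasible    : IsFractionalVC G ⊤ y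
      y-value       : sumOver ⊤ y + sumOver ⊤ y ≡ ℕ→ℚ ∣ C ∣ + ℕ→ℚ ∣ C ─ X ∣

  reduction : ∀ {C} → (∀ u v → Edge u v → u ∈ C ⊎ v ∈ C) → Reduction C
  reduction {C} cover =
    let T , maxT                 = argmax (surplus (∁ C)) C
        X , X⊆C , ∣C─X∣ , lb     = deficiency-removal (λ x∈C x∈∁C → x∈∁p⇒x∉p x∈∁C x∈C) maxT
        y , y-feasible , y-value = half-integral-cover T cover
    in record
      { X          = X
      ; ∣X∣+∣C─X∣  = trans (ℕP.+-comm ∣ X ∣ _) (∣p─q∣+∣q∣≡∣p∣ C X X⊆C)
      ; cover-G─X  = cover-without X cover
      ; lowerBound = lb
      ; y          = y
      ; y-feasible = y-feasible
      ; y-value    = trans y-value (cong (λ m → ℕ→ℚ ∣ C ∣ + ℕ→ℚ m) (sym ∣C─X∣))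
      }

gap-bound : ∀ {x m k} (q v : ℚ) → x ℕ.+ m ≡ k → q ≤ v → v + v ≡ ℕ→ℚ k + ℕ→ℚ m →
            ℕ→ℚ x ≤ ℕ→ℚ 2 * (ℕ→ℚ k - q)
gap-bound {x} {m} q v refl q≤v 2v≡k+m = begin
  X                                    ≡⟨ solve 2 (λ X M → X := ((X :+ M) :+ (X :+ M)) :- ((X :+ M) :+ M)) refl X M ⟩
  ((X + M) + (X + M)) - ((X + M) + M)  ≡⟨ cong (λ t → (t + t) - (t + M)) (ℕ→ℚ-+ x m) ⟨
  (K + K) - (K + M)                    ≡⟨ cong (λ t → (K + K) - t) 2v≡k+m ⟨
  (K + K) - (v + v)                    ≡⟨ solve 2 (λ K v → (K :+ K) :- (v :+ v) := (K :- v) :+ (K :- v)) refl K v ⟩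
  (K - v) + (K - v)                    ≤⟨ ℚP.+-mono-≤ K-v≤K-q K-v≤K-q ⟩
  (K - q) + (K - q)                    ≡⟨ solve 1 (λ t → t :+ t := (con 1ℚ :+ con 1ℚ) :* t) refl (K - q) ⟩
  ℕ→ℚ 2 * (K - q)                      ∎
  where
  open ℚP.≤-Reasoning
  X M K : ℚ
  X = ℕ→ℚ x
  M = ℕ→ℚ m
  K = ℕ→ℚ (x ℕ.+ m)
  K-v≤K-q : K - v ≤ K - q
  K-v≤K-q = ℚP.+-monoʳ-≤ K (ℚP.neg-antimono-≤ q≤v)

lemma42 : ∀ {n} (G : Graph n) (k : ℕ) (q : ℚ) →
          IsOPT G ⊤ k → IsLP G ⊤ q →
          Σ (Subset n) λ X →
            (ℕ→ℚ ∣ X ∣ ≤ ℕ→ℚ 2 * (ℕ→ℚ k - q))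
            × Σ ℕ λ m → IsOPT G (∁ X) m × IsLP G (∁ X) (ℕ→ℚ m)
lemma42 G k q ((C , (_ , C-covers) , refl) , _) (_ , LP-minimal) =
  X , gap-bound {x = ∣ X ∣} {m = ∣ C ─ X ∣} q (sumOver ⊤ y) ∣X∣+∣C─X∣ q≤value y-value ,
  ∣ C ─ X ∣ , integral-optimum G cover-G─X lowerBound
  where
  open Reduction (reduction G (λ u v → C-covers u v ∈⊤ ∈⊤))
  q≤value : q ≤ sumOver ⊤ y
  q≤value = subst (q ≤_) (lpValue≡sumOver ⊤ y) (LP-minimal y y-feasible)
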